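{- If $T$ is a tree of order $n(T)\geq 2$ with $l(T)$ leaves, then $\gamma_{t2}(T)\geq \frac{2[n(T)-l(T)+2]}{5}$.
   Context: For a graph $G$ without isolated vertices, a set $S\subseteq V(G)$ is a semitotal dominating set if every vertex of $V(G)\setminus S$ is adjacent to a vertex of $S$, and every vertex of $S$ is at distance at most $2$ (in $G$) from some other vertex of $S$. The semitotal domination number $\gamma_{t2}(G)$ is the minimum cardinality of a semitotal dominating set of $G$. For a tree $T$, $n(T)$ is its number of vertices and $l(T)$ its number of leaves (vertices of degree $1$). -}

module Defs where

open import Data.Nat using (ℕ; zero; suc; _+_; _*_; _∸_; _≤_)
open import Data.Fin using (Fin)
open import Data.Fin.Subset using (Subset; _∈_; _∉_; ∣_∣)
open import Data.Bool using (Bool; true; false)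
open import Data.List using (List; []; _∷_; length; filter)
open import Data.List.Relation.Unary.Unique.Propositional using (Unique)
open import Data.List.Relation.Unary.Linked using (Linked)
open import Data.Product using (Σ; ∃; _×_; _,_)
open import Data.Maybe using (just)
open import Data.Sum using (_⊎_)
open import Data.Bool using () renaming (_≟_ to _≟ᵇ_)
open import Data.List using () renaming (last to last?)
open import Data.List using (allFin)
open import Data.Nat.Base using () renaming (_≡ᵇ_ to _≡ᵇ_)
open import Relation.Binary.PropositionalEquality using (_≡_; _≢_)
open import Relation.Nullary using (¬_)

record Graph (n : ℕ) : Set where
  field
    adj     : Fin n → Fin n → Bool
    symm    : ∀ u v → adj u v ≡ adj v u
    irrefl  : ∀ v → adj v v ≡ false
open Graph public

Adj : ∀ {n} → Graph n → Fin n → Fin n → Set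
Adj G u v = adj G u v ≡ true

data Walk {n} (G : Graph n) : Fin n → Fin n → Set where
  [] : ∀ {v} → Walk G v v
  _∷_ : ∀ {u w v} → Adj G u w → Walk G w v → Walk G u v

Connected : ∀ {n} → Graph n → Set
Connected G = ∀ u v → Walk G u v

record Cycle {n} (G : Graph n) : Set where
  field
    first  : Fin n
    rest   : List (Fin n)
    long   : 2 ≤ length rest
    distinct : Unique (first ∷ rest)
    linked : Linked (Adj G) (first ∷ rest)
    closes : Σ (Fin n) λ last → last? (first ∷ rest) ≡ just last × Adj G last first

Acyclic : ∀ {n} → Graph n → Set
Acyclic G = ¬ Cycle G

IsTree : ∀ {n} → Graph n → Set
IsTree G = Connected G × Acyclic G

count : ∀ {n} → (Fin n → Bool) → ℕ
count {n} p = length (filter (λ i → p i ≟ᵇ true) (allFin n))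

degree : ∀ {n} → Graph n → Fin n → ℕ
degree G u = count (adj G u)

isLeaf : ∀ {n} → Graph n → Fin n → Bool
isLeaf G u = degree G u ≡ᵇ 1

leaves : ∀ {n} → Graph n → ℕ
leaves G = count (isLeaf G)

Dist≤2 : ∀ {n} → Graph n → Fin n → Fin n → Set
Dist≤2 G u v = u ≡ v ⊎ Adj G u v ⊎ Σ _ (λ w → Adj G u w × Adj G w v)

IsSemitotalDominating : ∀ {n} → Graph n → Subset n → Set
IsSemitotalDominating {n} G S =
  (∀ v → v ∉ S → Σ (Fin n) λ u → u ∈ S × Adj G u v) ×
  (∀ v → v ∈ S → Σ (Fin n) λ u → u ∈ S × u ≢ v × Dist≤2 G v u)

module Submission where

-- Let S be a semitotal dominating set of the tree T and let J be the set of
-- non-leaves outside S, split into M (at least two neighbours in S) and O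
-- (at most one).  For weights f, g on the vertices let
-- E(f,g) = Σ_u Σ_w f(u) g(w) [u ~ w]; on indicator functions this counts the
-- ordered adjacent pairs between two vertex sets.  Three local facts hold:
-- every vertex of S has a neighbour in S ∪ M (semitotality), every vertex of
-- J has a neighbour in S, and every vertex of O has a neighbour in J
-- (domination).  Together with E(M,S) ≥ 2|M| they bound E(X,X) from below
-- for X = S ∪ J, while X induces a nonempty forest, so E(X,X) ≤ 2(|X| − 1).
-- Comparing both bounds gives 2(|X| + 2) ≤ 5|S|, and every non-leaf is in X.

open import Defs
open import Data.Nat using (ℕ; zero; suc; _+_; _*_; _∸_; _≤_; _<_; z≤n; s≤s; _≤?_; _≡ᵇ_)
open import Data.Nat.Properties hiding (_≟_)
open import Data.Nat.Tactic.RingSolver using (solve-∀)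
open import Algebra.Properties.CommutativeSemigroup *-commutativeSemigroup using (x∙yz≈y∙xz)
open import Data.Bool using (Bool; true; false; not; _∧_; _∨_)
open import Data.Bool using () renaming (_≟_ to _≟ᵇ_)
open import Data.Bool.Properties using (not-injective)
open import Data.Fin using (Fin; zero; suc; punchIn; _≟_) renaming (_<_ to _<ᶠ_)
open import Data.Fin.Properties using (any?; pigeonhole; punchInᵢ≢i)
open import Data.Fin.Subset using (Subset; ∣_∣) renaming (_∈_ to _∈ˢ_; _∉_ to _∉ˢ_)
open import Data.Vec using (Vec; lookup)
open import Data.Vec.Properties using ([]=⇒lookup; lookup⇒[]=)
open import Data.Vec.Functional using (Vector; removeAt)
open import Data.List using (List; []; _∷_; length; filter; tabulate; last) renaming (lookup to lookupˡ)
open import Data.List.Relation.Unary.All as All using (_∷_)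
open import Data.List.Relation.Unary.All.Properties using (¬Any⇒All¬)
open import Data.List.Relation.Unary.Any using (here; there)
open import Data.List.Relation.Unary.AllPairs using ([]; _∷_)
open import Data.List.Relation.Unary.Unique.Propositional using (Unique)
open import Data.List.Relation.Unary.Linked using (Linked; []; [-]; _∷_)
open import Data.List.Membership.Propositional using (_∈_)
open import Data.List.Membership.Propositional.Properties using (∈-lookup)
open import Data.Maybe using (just)
open import Data.Product using (∃; _×_; _,_; proj₁; proj₂)
open import Data.Sum using (inj₁; inj₂)
open import Data.Empty using (⊥-elim)
open import Function using (_∘_)
open import Relation.Binary.PropositionalEquality using (_≡_; _≢_; refl; sym; trans; cong; cong₂; subst; subst₂; module ≡-Reasoning)
open import Relation.Nullary using (yes; no; does)
open import Relation.Nullary.Decidable using (_×-dec_)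

open import Algebra.Properties.Semiring.Sum +-*-semiring
  using (sum; sum-cong-≗; ∑-distrib-+; ∑-comm; *-distribˡ-sum; sum-replicate-zero; sum-remove)

sum-point : ∀ {n} (f : Vector ℕ n) i → f i ≤ sum f
sum-point f zero    = m≤m+n (f zero) _
sum-point f (suc i) = ≤-trans (sum-point (f ∘ suc) i) (m≤n+m _ (f zero))

sum-two : ∀ {n} (f : Vector ℕ n) {i j} → i ≢ j → f i + f j ≤ sum f
sum-two f {zero}  {zero}  i≢j = ⊥-elim (i≢j refl)
sum-two f {zero}  {suc j} _   = +-monoʳ-≤ (f zero) (sum-point (f ∘ suc) j)
sum-two f {suc i} {zero}  _   =
  ≤-trans (≤-reflexive (+-comm (f (suc i)) (f zero))) (+-monoʳ-≤ (f zero) (sum-point (f ∘ suc) i))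
sum-two f {suc i} {suc j} i≢j = ≤-trans (sum-two (f ∘ suc) (i≢j ∘ cong suc)) (m≤n+m _ (f zero))

sum-mono : ∀ {n} {f g : Vector ℕ n} → (∀ i → f i ≤ g i) → sum f ≤ sum g
sum-mono {zero}  _   = z≤n
sum-mono {suc n} f≤g = +-mono-≤ (f≤g zero) (sum-mono (f≤g ∘ suc))

sum-additive : ∀ {n} {f g h : Vector ℕ n} → (∀ i → f i ≡ g i + h i) → sum f ≡ sum g + sum h
sum-additive {g = g} {h} f≡g+h = trans (sum-cong-≗ f≡g+h) (∑-distrib-+ g h)

sum-scale : ∀ {n} k (f : Vector ℕ n) → sum (λ i → k * f i) ≡ k * sum f
sum-scale k f = sym (*-distribˡ-sum k f)

sum-zero : ∀ {n} {f : Vector ℕ n} → (∀ i → f i ≡ 0) → sum f ≡ 0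
sum-zero {n} f≡0 = trans (sum-cong-≗ f≡0) (sum-replicate-zero n)

sum-ones : ∀ n → sum {n} (λ _ → 1) ≡ n
sum-ones zero    = refl
sum-ones (suc n) = cong suc (sum-ones n)

sum-positive : ∀ {n} (f : Vector ℕ n) → 1 ≤ sum f → ∃ λ i → 1 ≤ f i
sum-positive {zero}  f ()
sum-positive {suc n} f pos with f zero in f₀
... | suc _ = zero , subst (1 ≤_) (sym f₀) (s≤s z≤n)
... | zero  with i , fᵢ ← sum-positive (f ∘ suc) pos = suc i , fᵢ

sum-positive-avoiding : ∀ {n} (f : Vector ℕ n) → (∀ i → f i ≤ 1) → 2 ≤ sum f →
  ∀ j → ∃ λ i → i ≢ j × 1 ≤ f i
sum-positive-avoiding {zero} f _ _ ()
sum-positive-avoiding {suc n} f f≤1 two j =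
  let i , fᵢ = sum-positive (removeAt f j) rest-positive in punchIn j i , punchInᵢ≢i j i , fᵢ
  where
  rest-positive : 1 ≤ sum (removeAt f j)
  rest-positive = +-cancelˡ-≤ 1 1 _
    (≤-trans (≤-trans two (≤-reflexive (sum-remove f))) (+-monoˡ-≤ _ (f≤1 j)))

χ : Bool → ℕ
χ true  = 1
χ false = 0

χ≤1 : ∀ b → χ b ≤ 1
χ≤1 true  = ≤-refl
χ≤1 false = z≤n

χ-complement : ∀ b → χ b + χ (not b) ≡ 1
χ-complement true  = refl
χ-complement false = refl

χ-∨ : ∀ a b → χ (a ∨ b) ≡ χ a + χ (not a ∧ b)
χ-∨ true  b = refl
χ-∨ false b = refl

χ-split : ∀ a c → χ a ≡ χ (a ∧ c) + χ (a ∧ not c)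
χ-split false c     = refl
χ-split true  true  = refl
χ-split true  false = refl

χ-∨ʳ : ∀ a b → χ b ≤ χ (a ∨ b)
χ-∨ʳ true  b = χ≤1 b
χ-∨ʳ false b = ≤-refl

χ-true : ∀ {b} → 1 ≤ χ b → b ≡ true
χ-true {true} _ = refl

χ*χ≤1 : ∀ b c → χ b * χ c ≤ 1
χ*χ≤1 b c = *-mono-≤ (χ≤1 b) (χ≤1 c)

χ*χ-true : ∀ b c → 1 ≤ χ b * χ c → b ≡ true × c ≡ true
χ*χ-true true  true  _ = refl , refl
χ*χ-true true  false ()
χ*χ-true false c     ()

ind : ∀ {n} → (Fin n → Bool) → Vector ℕ n
ind A u = χ (A u)

size : ∀ {n} → (Fin n → Bool) → ℕ
size A = sum (ind A)

size-witness : ∀ {n} (A : Fin n → Bool) → 1 ≤ size A → ∃ λ u → A u ≡ true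
size-witness A pos with u , Au ← sum-positive (ind A) pos = u , χ-true Au

size-empty : ∀ {n} {A : Fin n → Bool} → size A ≡ 0 → ∀ u → ind A u ≡ 0
size-empty {A = A} |A|≡0 u = n≤0⇒n≡0 (subst (ind A u ≤_) |A|≡0 (sum-point (ind A) u))

δ : ∀ {n} → Fin n → Vector ℕ n
δ v u = χ (does (u ≟ v))

sum-δ : ∀ {n} (v : Fin n) (f : Vector ℕ n) → sum (λ u → δ v u * f u) ≡ f v
sum-δ {suc n} zero    f =
  trans (cong₂ _+_ (+-identityʳ (f zero)) (sum-zero {n} (λ _ → refl))) (+-identityʳ (f zero))
sum-δ {suc n} (suc v) f = sum-δ v (f ∘ suc)

count≡size : ∀ {n} (p : Fin n → Bool) → count p ≡ size p
count≡size {n} p = filter-tabulate (λ i → i)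
  where
  filter-tabulate : ∀ {k} (g : Fin k → Fin n) →
    length (filter (λ i → p i ≟ᵇ true) (tabulate g)) ≡ sum (ind p ∘ g)
  filter-tabulate {zero}  g = refl
  filter-tabulate {suc k} g with p (g zero)
  ... | true  = cong suc (filter-tabulate (g ∘ suc))
  ... | false = filter-tabulate (g ∘ suc)

∣∣≡size : ∀ {n} (S : Subset n) → ∣ S ∣ ≡ size (lookup S)
∣∣≡size Vec.[]          = refl
∣∣≡size (true Vec.∷ S)  = cong suc (∣∣≡size S)
∣∣≡size (false Vec.∷ S) = ∣∣≡size S

-- Weighted degrees and the edge form of a graph

module Degrees {n} (G : Graph n) where

  adj-sym : ∀ {u v} → Adj G u v → Adj G v u
  adj-sym {u} {v} u~v = trans (symm G v u) u~v

  adj-irrefl : ∀ {u v} → Adj G u v → u ≢ v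
  adj-irrefl {u} u~u refl with () ← trans (sym u~u) (irrefl G u)

  a : Fin n → Fin n → ℕ
  a u w = χ (adj G u w)

  a-sym : ∀ u w → a u w ≡ a w u
  a-sym u w = cong χ (symm G u w)

  a-diagonal : ∀ v → a v v ≡ 0
  a-diagonal v = cong χ (irrefl G v)

  -- Weighted degree Σ_w g(w)·a(u,w); deg (ind B) u = |N(u) ∩ B|.
  deg : Vector ℕ n → Fin n → ℕ
  deg g u = sum λ w → g w * a u w

  -- The edge form E(f,g) = Σ_u f(u)·deg g u; E (ind A) (ind B) counts the
  -- ordered pairs (u,w) ∈ A × B with u ~ w.
  E : Vector ℕ n → Vector ℕ n → ℕ
  E f g = sum λ u → f u * deg g u

  deg-additive : ∀ g₁ g₂ {g} → (∀ w → g w ≡ g₁ w + g₂ w) → ∀ u → deg g u ≡ deg g₁ u + deg g₂ u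
  deg-additive g₁ g₂ {g} g≡ u =
    sum-additive λ w → trans (cong (_* a u w) (g≡ w)) (*-distribʳ-+ (a u w) (g₁ w) (g₂ w))

  E-additiveˡ : ∀ f₁ f₂ {f} g → (∀ u → f u ≡ f₁ u + f₂ u) → E f g ≡ E f₁ g + E f₂ g
  E-additiveˡ f₁ f₂ {f} g f≡ =
    sum-additive λ u → trans (cong (_* deg g u) (f≡ u)) (*-distribʳ-+ (deg g u) (f₁ u) (f₂ u))

  E-additiveʳ : ∀ f g₁ g₂ {g} → (∀ w → g w ≡ g₁ w + g₂ w) → E f g ≡ E f g₁ + E f g₂
  E-additiveʳ f g₁ g₂ {g} g≡ =
    sum-additive λ u → trans (cong (f u *_) (deg-additive g₁ g₂ g≡ u)) (*-distribˡ-+ (f u) (deg g₁ u) (deg g₂ u))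

  E-symmetric : ∀ f g → E f g ≡ E g f
  E-symmetric f g = begin
    sum (λ u → f u * sum (λ w → g w * a u w))   ≡⟨ sum-cong-≗ (λ u → sym (sum-scale (f u) (λ w → g w * a u w))) ⟩
    sum (λ u → sum (λ w → f u * (g w * a u w))) ≡⟨ ∑-comm (λ u w → f u * (g w * a u w)) ⟩
    sum (λ w → sum (λ u → f u * (g w * a u w))) ≡⟨ sum-cong-≗ (λ w → sum-cong-≗ (λ u → swap w u)) ⟩
    sum (λ w → sum (λ u → g w * (f u * a w u))) ≡⟨ sum-cong-≗ (λ w → sum-scale (g w) (λ u → f u * a w u)) ⟩
    sum (λ w → g w * sum (λ u → f u * a w u))   ∎
    where
    open ≡-Reasoning
    swap : ∀ w u → f u * (g w * a u w) ≡ g w * (f u * a w u)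
    swap w u = trans (x∙yz≈y∙xz (f u) (g w) (a u w)) (cong (λ t → g w * (f u * t)) (a-sym u w))

  E-square : ∀ f₁ f₂ {f} → (∀ u → f u ≡ f₁ u + f₂ u) → E f f ≡ E f₁ f₁ + 2 * E f₂ f₁ + E f₂ f₂
  E-square f₁ f₂ {f} f≡ = begin
    E f f                                 ≡⟨ E-additiveˡ f₁ f₂ f f≡ ⟩
    E f₁ f + E f₂ f                       ≡⟨ cong₂ _+_ (E-additiveʳ f₁ f₁ f₂ f≡) (E-additiveʳ f₂ f₁ f₂ f≡) ⟩
    (E f₁ f₁ + E f₁ f₂) + (E f₂ f₁ + E f₂ f₂) ≡⟨ cong (λ t → (E f₁ f₁ + t) + (E f₂ f₁ + E f₂ f₂)) (E-symmetric f₁ f₂) ⟩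
    (E f₁ f₁ + E f₂ f₁) + (E f₂ f₁ + E f₂ f₂) ≡⟨ regroup (E f₁ f₁) (E f₂ f₁) (E f₂ f₂) ⟩
    E f₁ f₁ + 2 * E f₂ f₁ + E f₂ f₂       ∎
    where
    open ≡-Reasoning
    regroup : ∀ x y z → (x + y) + (y + z) ≡ x + 2 * y + z
    regroup = solve-∀

  deg-δ : ∀ v u → deg (δ v) u ≡ a u v
  deg-δ v u = sum-δ v (a u)

  E-δ : ∀ v g → E (δ v) g ≡ deg g v
  E-δ v g = sum-δ v (λ u → deg g u)

  E-lower-bound : ∀ (A : Fin n → Bool) g k → (∀ u → A u ≡ true → k ≤ deg g u) → k * size A ≤ E (ind A) g
  E-lower-bound A g k k≤deg = ≤-trans (≤-reflexive (sym (sum-scale k (ind A)))) (sum-mono term)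
    where
    term : ∀ u → k * ind A u ≤ ind A u * deg g u
    term u with A u in Au
    ... | true  = ≤-trans (≤-reflexive (*-identityʳ k)) (≤-trans (k≤deg u Au) (≤-reflexive (sym (+-identityʳ _))))
    ... | false = ≤-reflexive (*-zeroʳ k)

  neighbour⇒deg≥1 : ∀ (B : Fin n → Bool) {u w} → B w ≡ true → Adj G u w → 1 ≤ deg (ind B) u
  neighbour⇒deg≥1 B {u} {w} Bw u~w =
    ≤-trans (≤-reflexive (sym (cong₂ (λ b c → χ b * χ c) Bw u~w))) (sum-point (λ w → ind B w * a u w) w)

  two-neighbours⇒deg≥2 : ∀ (B : Fin n → Bool) {u w₁ w₂} → w₁ ≢ w₂ → B w₁ ≡ true → B w₂ ≡ true →
    Adj G u w₁ → Adj G u w₂ → 2 ≤ deg (ind B) u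
  two-neighbours⇒deg≥2 B {u} {w₁} {w₂} w₁≢w₂ Bw₁ Bw₂ u~w₁ u~w₂ = ≤-trans
    (≤-reflexive (sym (cong₂ _+_ (cong₂ (λ b c → χ b * χ c) Bw₁ u~w₁) (cong₂ (λ b c → χ b * χ c) Bw₂ u~w₂))))
    (sum-two (λ w → ind B w * a u w) w₁≢w₂)

  deg≥1⇒neighbour : ∀ (B : Fin n → Bool) u → 1 ≤ deg (ind B) u → ∃ λ w → B w ≡ true × Adj G u w
  deg≥1⇒neighbour B u pos with w , term ← sum-positive (λ w → ind B w * a u w) pos =
    w , χ*χ-true (B w) (adj G u w) term

  deg≥2⇒other-neighbour : ∀ (B : Fin n → Bool) u → 2 ≤ deg (ind B) u →
    ∀ x → ∃ λ w → w ≢ x × B w ≡ true × Adj G u w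
  deg≥2⇒other-neighbour B u two x
    with w , w≢x , term ← sum-positive-avoiding (λ w → ind B w * a u w) (λ w → χ*χ≤1 (B w) (adj G u w)) two x =
    w , w≢x , χ*χ-true (B w) (adj G u w) term

  degree≡deg : ∀ u → degree G u ≡ deg (λ _ → 1) u
  degree≡deg u = trans (count≡size (adj G u)) (sum-cong-≗ (λ w → sym (*-identityˡ (a u w))))

  degree-split : ∀ (B : Fin n → Bool) u → degree G u ≡ deg (ind B) u + deg (ind (not ∘ B)) u
  degree-split B u = trans (degree≡deg u) (deg-additive (ind B) (ind (not ∘ B)) (λ w → sym (χ-complement (B w))) u)

  degree≥2⇒nonleaf : ∀ u → 2 ≤ degree G u → isLeaf G u ≡ false
  degree≥2⇒nonleaf u two with degree G u | two
  ... | suc (suc _) | _         = refl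
  ... | suc zero    | s≤s ()

  nonleaf⇒degree≢1 : ∀ u → isLeaf G u ≡ false → degree G u ≢ 1
  nonleaf⇒degree≢1 u nonleaf degree≡1 with () ← trans (sym (cong (_≡ᵇ 1) degree≡1)) nonleaf

unique-lookup : ∀ {A : Set} {xs : List A} → Unique xs →
  ∀ i j → i <ᶠ j → lookupˡ xs i ≢ lookupˡ xs j
unique-lookup (x∉xs ∷ _)    zero    (suc j) _         = All.lookup x∉xs (∈-lookup j)
unique-lookup (_ ∷ distinct) (suc i) (suc j) (s≤s i<j) = unique-lookup distinct i j i<j

unique-length≤ : ∀ {n} (xs : List (Fin n)) → Unique xs → length xs ≤ n
unique-length≤ {n} xs distinct with length xs ≤? n
... | yes bounded = bounded
... | no too-long with i , j , i<j , same ← pigeonhole (≰⇒> too-long) (lookupˡ xs) =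
  ⊥-elim (unique-lookup distinct i j i<j same)

prefix-to : ∀ {A : Set} {w : A} (xs : List A) → w ∈ xs → List A
prefix-to (x ∷ _)  (here _)     = x ∷ []
prefix-to (x ∷ xs) (there w∈xs) = x ∷ prefix-to xs w∈xs

prefix-nonempty : ∀ {A : Set} {w : A} (xs : List A) (w∈xs : w ∈ xs) → 1 ≤ length (prefix-to xs w∈xs)
prefix-nonempty (_ ∷ _) (here _)  = s≤s z≤n
prefix-nonempty (_ ∷ _) (there _) = s≤s z≤n

prefix-last : ∀ {A : Set} {w : A} (y : A) (xs : List A) (w∈xs : w ∈ xs) →
  last (y ∷ prefix-to xs w∈xs) ≡ just w
prefix-last y (x ∷ xs) (here w≡x)   = cong just (sym w≡x)
prefix-last y (x ∷ xs) (there w∈xs) = prefix-last x xs w∈xs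

prefix-all : ∀ {A : Set} {P : A → Set} {w : A} (xs : List A) (w∈xs : w ∈ xs) →
  All.All P xs → All.All P (prefix-to xs w∈xs)
prefix-all (_ ∷ _)  (here _)     (px ∷ _)   = px ∷ All.[]
prefix-all (_ ∷ xs) (there w∈xs) (px ∷ pxs) = px ∷ prefix-all xs w∈xs pxs

prefix-unique : ∀ {A : Set} {w : A} (xs : List A) (w∈xs : w ∈ xs) → Unique xs → Unique (prefix-to xs w∈xs)
prefix-unique (_ ∷ _)  (here _)     (_ ∷ _)          = All.[] ∷ []
prefix-unique (_ ∷ xs) (there w∈xs) (x∉xs ∷ distinct) =
  prefix-all xs w∈xs x∉xs ∷ prefix-unique xs w∈xs distinct

prefix-linked : ∀ {A : Set} {R : A → A → Set} {w : A} (y : A) (xs : List A) (w∈xs : w ∈ xs) →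
  Linked R (y ∷ xs) → Linked R (y ∷ prefix-to xs w∈xs)
prefix-linked y (_ ∷ _)  (here _)     (r ∷ _)      = r ∷ [-]
prefix-linked y (x ∷ xs) (there w∈xs) (r ∷ linked) = r ∷ prefix-linked x xs w∈xs linked

-- Cycles and forests

module Forests {n} (G : Graph n) where
  open Degrees G

  -- If every vertex of X has at least two neighbours in X, a non-backtracking
  -- walk inside X must eventually revisit a vertex, which closes a cycle.
  module CycleInside (X : Fin n → Bool) (min-degree-2 : ∀ v → X v ≡ true → 2 ≤ deg (ind X) v) where
    open import Data.List.Membership.DecPropositional (_≟_ {n}) using (_∈?_)

    -- The path cur ∷ prev ∷ path is kept newest-first, with distinct vertices;
    -- the fuel outlasts the at most n vertices such a path can have.
    extend : (fuel : ℕ) (cur prev : Fin n) (path : List (Fin n)) → X cur ≡ true →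
      Unique (cur ∷ prev ∷ path) → Linked (Adj G) (cur ∷ prev ∷ path) →
      n < fuel + length (cur ∷ prev ∷ path) → Cycle G
    extend zero cur prev path _ distinct _ long = ⊥-elim (<⇒≱ long (unique-length≤ _ distinct))
    extend (suc fuel) cur prev path Xcur distinct linked long
      with w , w≢prev , Xw , cur~w ← deg≥2⇒other-neighbour X cur (min-degree-2 cur Xcur) prev
      with w ∈? (cur ∷ prev ∷ path)
    ... | no w∉path = extend fuel w cur (prev ∷ path) Xw (¬Any⇒All¬ _ w∉path ∷ distinct)
            (adj-sym cur~w ∷ linked) (≤-trans long (≤-reflexive (sym (+-suc fuel _))))
    ... | yes (here w≡cur)         = ⊥-elim (adj-irrefl cur~w (sym w≡cur))
    ... | yes (there (here w≡prev)) = ⊥-elim (w≢prev w≡prev)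
    ... | yes (there (there w∈path)) = record
      { first    = cur
      ; rest     = prev ∷ prefix-to path w∈path
      ; long     = s≤s (prefix-nonempty path w∈path)
      ; distinct = prefix-unique (cur ∷ prev ∷ path) (there (there w∈path)) distinct
      ; linked   = prefix-linked cur (prev ∷ path) (there w∈path) linked
      ; closes   = w , prefix-last cur (prev ∷ path) (there w∈path) , adj-sym cur~w
      }

    cycle : ∀ x → X x ≡ true → Cycle G
    cycle x Xx with x₁ , x₁≢x , Xx₁ , x~x₁ ← deg≥2⇒other-neighbour X x (min-degree-2 x Xx) x =
      extend n x₁ x [] Xx₁ ((x₁≢x ∷ All.[]) ∷ (All.[] ∷ [])) (adj-sym x~x₁ ∷ [-])
        (≤-trans (n≤1+n (suc n)) (≤-reflexive (+-comm 2 n)))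

  low-degree-vertex : Acyclic G → (X : Fin n → Bool) → ∀ {x} → X x ≡ true →
    ∃ λ v → X v ≡ true × deg (ind X) v ≤ 1
  low-degree-vertex acyclic X {x} Xx with any? (λ v → (X v ≟ᵇ true) ×-dec (deg (ind X) v ≤? 1))
  ... | yes found = found
  ... | no none   = ⊥-elim (acyclic (CycleInside.cycle X min-degree-2 x Xx))
    where
    min-degree-2 : ∀ v → X v ≡ true → 2 ≤ deg (ind X) v
    min-degree-2 v Xv = ≰⇒> (λ deg≤1 → none (v , Xv , deg≤1))

  delete : (Fin n → Bool) → Fin n → Fin n → Bool
  delete Y v u = Y u ∧ not (does (u ≟ v))

  delete-split : ∀ Y {v} → Y v ≡ true → ∀ u → ind Y u ≡ ind (delete Y v) u + δ v u
  delete-split Y {v} Yv u with u ≟ v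
  ... | yes refl rewrite Yv = refl
  ... | no _     with Y u
  ...   | true  = refl
  ...   | false = refl

  delete-size : ∀ Y {v} → Y v ≡ true → size Y ≡ size (delete Y v) + 1
  delete-size Y {v} Yv = trans (sum-additive (delete-split Y Yv))
    (cong (size (delete Y v) +_) (trans (sum-cong-≗ (λ u → sym (*-identityʳ (δ v u)))) (sum-δ v (λ _ → 1))))

  delete-deg : ∀ Y {v} → Y v ≡ true → deg (ind Y) v ≡ deg (ind (delete Y v)) v
  delete-deg Y {v} Yv = begin
    deg (ind Y) v                             ≡⟨ deg-additive (ind (delete Y v)) (δ v) (delete-split Y Yv) v ⟩
    deg (ind (delete Y v)) v + deg (δ v) v    ≡⟨ cong (deg (ind (delete Y v)) v +_) (trans (deg-δ v v) (a-diagonal v)) ⟩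
    deg (ind (delete Y v)) v + 0              ≡⟨ +-identityʳ _ ⟩
    deg (ind (delete Y v)) v                  ∎
    where open ≡-Reasoning

  delete-edges : ∀ Y {v} → Y v ≡ true →
    E (ind Y) (ind Y) ≡ E (ind (delete Y v)) (ind (delete Y v)) + 2 * deg (ind (delete Y v)) v
  delete-edges Y {v} Yv = begin
    E (ind Y) (ind Y)                  ≡⟨ E-square Y′ (δ v) (delete-split Y Yv) ⟩
    E Y′ Y′ + 2 * E (δ v) Y′ + E (δ v) (δ v) ≡⟨ cong₂ (λ s t → E Y′ Y′ + 2 * s + t) (E-δ v Y′) (E-δ v (δ v)) ⟩
    E Y′ Y′ + 2 * deg Y′ v + deg (δ v) v     ≡⟨ cong (E Y′ Y′ + 2 * deg Y′ v +_) (trans (deg-δ v v) (a-diagonal v)) ⟩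
    E Y′ Y′ + 2 * deg Y′ v + 0               ≡⟨ +-identityʳ _ ⟩
    E Y′ Y′ + 2 * deg Y′ v                   ∎
    where
    open ≡-Reasoning
    Y′ = ind (delete Y v)

  -- A vertex set of a forest with k + 1 vertices spans at most k edges, i.e.
  -- E(Y,Y) ≤ 2k; proved by deleting a vertex of degree at most one.
  forest-edge-bound-of-size : Acyclic G → ∀ k (Y : Fin n → Bool) → size Y ≡ suc k →
    E (ind Y) (ind Y) + 2 ≤ 2 * suc k
  forest-edge-bound-of-size acyclic k Y |Y|≡1+k
    with x , Yx ← size-witness Y (≤-trans (s≤s z≤n) (≤-reflexive (sym |Y|≡1+k)))
    with v , Yv , few ← low-degree-vertex acyclic Y Yx =
    begin
      E (ind Y) (ind Y) + 2         ≡⟨ cong (_+ 2) (delete-edges Y Yv) ⟩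
      E Y′ Y′ + 2 * deg Y′ v + 2    ≤⟨ bound k |Y′|≡k ⟩
      2 * suc k                     ∎
    where
    open ≤-Reasoning
    Y′ = ind (delete Y v)
    |Y′|≡k : size (delete Y v) ≡ k
    |Y′|≡k = +-cancelʳ-≡ 1 _ k (trans (sym (delete-size Y Yv)) (trans |Y|≡1+k (+-comm 1 k)))
    bound : ∀ j → size (delete Y v) ≡ j → E Y′ Y′ + 2 * deg Y′ v + 2 ≤ 2 * suc j
    bound zero    empty = ≤-reflexive (cong₂ (λ s t → s + 2 * t + 2)
      (sum-zero (λ u → cong (_* deg Y′ u) (size-empty empty u)))
      (sum-zero (λ w → cong (_* a v w) (size-empty empty w))))
    bound (suc j) |Y′|≡1+j = begin
      E Y′ Y′ + 2 * deg Y′ v + 2    ≡⟨ +-comm-middle (E Y′ Y′) (2 * deg Y′ v) 2 ⟩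
      (E Y′ Y′ + 2) + 2 * deg Y′ v  ≤⟨ +-mono-≤ (forest-edge-bound-of-size acyclic j (delete Y v) |Y′|≡1+j)
                                               (*-monoʳ-≤ 2 (≤-trans (≤-reflexive (sym (delete-deg Y Yv))) few)) ⟩
      2 * suc j + 2 * 1             ≡⟨ sym (*-distribˡ-+ 2 (suc j) 1) ⟩
      2 * (suc j + 1)               ≡⟨ cong (2 *_) (+-comm (suc j) 1) ⟩
      2 * suc (suc j)               ∎
      where
      +-comm-middle : ∀ x y z → x + y + z ≡ (x + z) + y
      +-comm-middle = solve-∀

  forest-edge-bound : Acyclic G → ∀ (Y : Fin n → Bool) {x} → Y x ≡ true → E (ind Y) (ind Y) + 2 ≤ 2 * size Y
  forest-edge-bound acyclic Y {x} Yx with size Y in |Y| | sum-point (ind Y) x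
  ... | suc k | _ = forest-edge-bound-of-size acyclic k Y |Y|
  ... | zero  | x∈Y rewrite Yx with () ← x∈Y

-- The arithmetic of the double count.  Doubling the forest bound and
-- inserting the local bounds gives s + 6m + 6o + 4 ≤ 4(s + m + o), that is
-- 2m + 2o + 4 ≤ 3s.
counting-arithmetic : ∀ {s m o A B C D} →
  A + 2 * (B + C) + D + 2 ≤ 2 * (s + (m + o)) →
  s ≤ A + B → 2 * m ≤ B → o ≤ C → o ≤ D →
  2 * (s + (m + o) + 2) ≤ 5 * s
counting-arithmetic {s} {m} {o} {A} {B} {C} {D} forest s≤A+B 2m≤B o≤C o≤D =
  +-cancelʳ-≤ (4 * (m + o)) _ _ (begin
    2 * (s + (m + o) + 2) + 4 * (m + o)          ≡⟨ expand s m o ⟩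
    s + (s + 0 + 3 * (2 * m) + 4 * o + 2 * o + 4) ≤⟨ +-monoʳ-≤ s local-bounds ⟩
    s + ((A + B) + A + 3 * B + 4 * C + 2 * D + 4) ≡⟨ cong (s +_) (regroup A B C D) ⟩
    s + 2 * (A + 2 * (B + C) + D + 2)             ≤⟨ +-monoʳ-≤ s (*-monoʳ-≤ 2 forest) ⟩
    s + 2 * (2 * (s + (m + o)))                   ≡⟨ collect s m o ⟩
    5 * s + 4 * (m + o)                           ∎)
  where
  open ≤-Reasoning
  local-bounds : s + 0 + 3 * (2 * m) + 4 * o + 2 * o + 4 ≤ (A + B) + A + 3 * B + 4 * C + 2 * D + 4
  local-bounds = +-monoˡ-≤ 4 (+-mono-≤ (+-mono-≤ (+-mono-≤ (+-mono-≤ s≤A+B z≤n)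
    (*-monoʳ-≤ 3 2m≤B)) (*-monoʳ-≤ 4 o≤C)) (*-monoʳ-≤ 2 o≤D))
  expand : ∀ s m o → 2 * (s + (m + o) + 2) + 4 * (m + o) ≡ s + (s + 0 + 3 * (2 * m) + 4 * o + 2 * o + 4)
  expand = solve-∀
  regroup : ∀ A B C D → (A + B) + A + 3 * B + 4 * C + 2 * D + 4 ≡ 2 * (A + 2 * (B + C) + D + 2)
  regroup = solve-∀
  collect : ∀ s m o → s + 2 * (2 * (s + (m + o))) ≡ 5 * s + 4 * (m + o)
  collect = solve-∀

-- The local structure around a semitotal dominating set

atLeastTwo : ℕ → Bool
atLeastTwo (suc (suc _)) = true
atLeastTwo _             = false

atLeastTwo-sound : ∀ {d} → atLeastTwo d ≡ true → 2 ≤ d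
atLeastTwo-sound {suc (suc _)} _ = s≤s (s≤s z≤n)

atLeastTwo-complete : ∀ {d} → 2 ≤ d → atLeastTwo d ≡ true
atLeastTwo-complete (s≤s (s≤s _)) = refl

atLeastTwo-false : ∀ {d} → atLeastTwo d ≡ false → d ≤ 1
atLeastTwo-false {zero}        _ = z≤n
atLeastTwo-false {suc zero}    _ = s≤s z≤n

module SemitotalStructure {n} (T : Graph n) (S : Subset n) (semi : IsSemitotalDominating T S) where
  open Degrees T

  inS : Fin n → Bool
  inS = lookup S

  ∈S⇒inS : ∀ {v} → v ∈ˢ S → inS v ≡ true
  ∈S⇒inS = []=⇒lookup

  inS⇒∈S : ∀ {v} → inS v ≡ true → v ∈ˢ S
  inS⇒∈S {v} = lookup⇒[]= v S

  ¬inS⇒∉S : ∀ {v} → inS v ≡ false → v ∉ˢ S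
  ¬inS⇒∉S v∉S v∈S with () ← trans (sym (∈S⇒inS v∈S)) v∉S

  dominated : ∀ v → inS v ≡ false → ∃ λ u → inS u ≡ true × Adj T u v
  dominated v v∉S with u , u∈S , u~v ← proj₁ semi v (¬inS⇒∉S v∉S) = u , ∈S⇒inS u∈S , u~v

  nonleaf : Fin n → Bool
  nonleaf u = not (isLeaf T u)

  X J M O : Fin n → Bool
  X u = inS u ∨ nonleaf u
  J u = not (inS u) ∧ nonleaf u
  M u = J u ∧ atLeastTwo (deg (ind inS) u)
  O u = J u ∧ not (atLeastTwo (deg (ind inS) u))


  J-parts : ∀ u → J u ≡ true → inS u ≡ false × isLeaf T u ≡ false
  J-parts u Ju with inS u | isLeaf T u | Ju
  ... | false | false | _ = refl , refl

  J-intro : ∀ u → inS u ≡ false → isLeaf T u ≡ false → J u ≡ true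
  J-intro u u∉S nonleaf-u rewrite u∉S | nonleaf-u = refl

  M-parts : ∀ u → M u ≡ true → J u ≡ true × 2 ≤ deg (ind inS) u
  M-parts u Mu with J u | atLeastTwo (deg (ind inS) u) in many | Mu
  ... | true | true | _ = refl , atLeastTwo-sound many

  M-intro : ∀ u → J u ≡ true → 2 ≤ deg (ind inS) u → M u ≡ true
  M-intro u Ju two rewrite Ju | atLeastTwo-complete two = refl

  O-parts : ∀ u → O u ≡ true → J u ≡ true × deg (ind inS) u ≤ 1
  O-parts u Ou with J u | atLeastTwo (deg (ind inS) u) in many | Ou
  ... | true | false | _ = refl , atLeastTwo-false many

  two-neighbours⇒nonleaf : ∀ {x u₁ u₂} → u₁ ≢ u₂ → Adj T x u₁ → Adj T x u₂ → isLeaf T x ≡ false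
  two-neighbours⇒nonleaf {x} u₁≢u₂ x~u₁ x~u₂ = degree≥2⇒nonleaf x
    (subst (2 ≤_) (sym (degree≡deg x)) (two-neighbours⇒deg≥2 (λ _ → true) u₁≢u₂ refl refl x~u₁ x~u₂))

  J-has-S-neighbour : ∀ u → J u ≡ true → 1 ≤ deg (ind inS) u
  J-has-S-neighbour u Ju with w , Sw , w~u ← dominated u (proj₁ (J-parts u Ju)) =
    neighbour⇒deg≥1 inS Sw (adj-sym w~u)

  -- A vertex of O is a non-leaf with exactly one neighbour in S, so it also
  -- has a neighbour outside S.
  O-has-outside-neighbour : ∀ u → O u ≡ true → 1 ≤ deg (ind (not ∘ inS)) u
  O-has-outside-neighbour u Ou with deg (ind (not ∘ inS)) u in none
  ... | suc _ = s≤s z≤n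
  ... | zero  = ⊥-elim (nonleaf⇒degree≢1 u (proj₂ (J-parts u Ju)) (begin
    degree T u                                ≡⟨ degree-split inS u ⟩
    deg (ind inS) u + deg (ind (not ∘ inS)) u ≡⟨ cong (deg (ind inS) u +_) none ⟩
    deg (ind inS) u + 0                       ≡⟨ +-identityʳ _ ⟩
    deg (ind inS) u                           ≡⟨ ≤-antisym (proj₂ (O-parts u Ou)) (J-has-S-neighbour u Ju) ⟩
    1                                         ∎))
    where
    open ≡-Reasoning
    Ju = proj₁ (O-parts u Ou)

  in-and-out-differ : ∀ {y u} → inS y ≡ true → inS u ≡ false → y ≢ u
  in-and-out-differ Sy u∉S refl with () ← trans (sym Sy) u∉S

  -- Every vertex u of O has a neighbour in J: its neighbour x outside S is
  -- dominated by some y ∈ S, y ≠ u, so x has two neighbours and lies in J.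
  O-has-J-neighbour : ∀ u → O u ≡ true → 1 ≤ deg (ind J) u
  O-has-J-neighbour u Ou
    with x , x∉S , u~x ← deg≥1⇒neighbour (not ∘ inS) u (O-has-outside-neighbour u Ou)
    with y , Sy , y~x ← dominated x (not-injective x∉S) =
    neighbour⇒deg≥1 J (J-intro x (not-injective x∉S) (two-neighbours⇒nonleaf y≢u (adj-sym y~x) (adj-sym u~x))) u~x
    where
    y≢u = in-and-out-differ Sy (proj₁ (J-parts u (proj₁ (O-parts u Ou))))

  -- Its partner
  -- w ∈ S is adjacent to u or shares a neighbour z with it; if z ∉ S then z
  -- has the two neighbours u, w in S and so lies in M.
  S-has-S∪M-neighbour : ∀ u → inS u ≡ true → 1 ≤ deg (ind inS) u + deg (ind M) u
  S-has-S∪M-neighbour u Su with proj₂ semi u (inS⇒∈S Su)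
  ... | w , _    , w≢u , inj₁ u≡w        = ⊥-elim (w≢u (sym u≡w))
  ... | w , w∈S  , _   , inj₂ (inj₁ u~w) = ≤-trans (neighbour⇒deg≥1 inS (∈S⇒inS w∈S) u~w) (m≤m+n _ _)
  ... | w , w∈S  , w≢u , inj₂ (inj₂ (z , u~z , z~w)) with inS z in Sz
  ...   | true  = ≤-trans (neighbour⇒deg≥1 inS Sz u~z) (m≤m+n _ _)
  ...   | false = ≤-trans (neighbour⇒deg≥1 M Mz u~z) (m≤n+m _ _)
    where
    u≢w : u ≢ w
    u≢w = w≢u ∘ sym
    Mz : M z ≡ true
    Mz = M-intro z (J-intro z Sz (two-neighbours⇒nonleaf u≢w (adj-sym u~z) z~w))
      (two-neighbours⇒deg≥2 inS u≢w Su (∈S⇒inS w∈S) (adj-sym u~z) z~w)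

  X-split : ∀ u → ind X u ≡ ind inS u + ind J u
  X-split u = χ-∨ (inS u) (nonleaf u)

  J-split : ∀ u → ind J u ≡ ind M u + ind O u
  J-split u = χ-split (J u) (atLeastTwo (deg (ind inS) u))

  size-X : size X ≡ size inS + (size M + size O)
  size-X = trans (sum-additive X-split) (cong (size inS +_) (sum-additive J-split))

  edges-X : E (ind X) (ind X) ≡ E (ind inS) (ind inS) + 2 * (E (ind M) (ind inS) + E (ind O) (ind inS)) + E (ind J) (ind J)
  edges-X = trans (E-square (ind inS) (ind J) X-split)
    (cong (λ t → E (ind inS) (ind inS) + 2 * t + E (ind J) (ind J)) (E-additiveˡ (ind M) (ind O) (ind inS) J-split))

  S-bound : size inS ≤ E (ind inS) (ind inS) + E (ind M) (ind inS)
  S-bound = begin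
    size inS                                        ≡⟨ sym (*-identityˡ (size inS)) ⟩
    1 * size inS                                    ≤⟨ E-lower-bound inS S+M 1 has-neighbour ⟩
    E (ind inS) S+M                                 ≡⟨ E-additiveʳ (ind inS) (ind inS) (ind M) (λ _ → refl) ⟩
    E (ind inS) (ind inS) + E (ind inS) (ind M)     ≡⟨ cong (E (ind inS) (ind inS) +_) (E-symmetric (ind inS) (ind M)) ⟩
    E (ind inS) (ind inS) + E (ind M) (ind inS)     ∎
    where
    open ≤-Reasoning
    S+M : Vector ℕ n
    S+M w = ind inS w + ind M w
    has-neighbour : ∀ u → inS u ≡ true → 1 ≤ deg S+M u
    has-neighbour u Su = ≤-trans (S-has-S∪M-neighbour u Su)
      (≤-reflexive (sym (deg-additive (ind inS) (ind M) (λ _ → refl) u)))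

  M-bound : 2 * size M ≤ E (ind M) (ind inS)
  M-bound = E-lower-bound M (ind inS) 2 (λ u Mu → proj₂ (M-parts u Mu))

  O-S-bound : size O ≤ E (ind O) (ind inS)
  O-S-bound = ≤-trans (≤-reflexive (sym (*-identityˡ (size O))))
    (E-lower-bound O (ind inS) 1 (λ u Ou → J-has-S-neighbour u (proj₁ (O-parts u Ou))))

  O-J-bound : size O ≤ E (ind J) (ind J)
  O-J-bound = begin
    size O                                    ≡⟨ sym (*-identityˡ (size O)) ⟩
    1 * size O                                ≤⟨ E-lower-bound O (ind J) 1 O-has-J-neighbour ⟩
    E (ind O) (ind J)                         ≤⟨ m≤n+m _ _ ⟩
    E (ind M) (ind J) + E (ind O) (ind J)     ≡⟨ sym (E-additiveˡ (ind M) (ind O) (ind J) J-split) ⟩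
    E (ind J) (ind J)                         ∎
    where open ≤-Reasoning

  nonleaves≤size-X : n ∸ leaves T ≤ size X
  nonleaves≤size-X = begin
    n ∸ leaves T                      ≡⟨ cong (_∸ leaves T) vertices ⟩
    leaves T + size nonleaf ∸ leaves T ≡⟨ m+n∸m≡n (leaves T) (size nonleaf) ⟩
    size nonleaf                      ≤⟨ sum-mono (λ u → χ-∨ʳ (inS u) (nonleaf u)) ⟩
    size X                            ∎
    where
    open ≤-Reasoning
    vertices : n ≡ leaves T + size nonleaf
    vertices = trans (sym (sum-ones n))
      (trans (sum-additive (λ u → sym (χ-complement (isLeaf T u)))) (cong (_+ size nonleaf) (sym (count≡size (isLeaf T)))))

  S-nonempty : Fin n → ∃ λ u → inS u ≡ true
  S-nonempty v with inS v in Sv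
  ... | true  = v , Sv
  ... | false with u , Su , _ ← dominated v Sv = u , Su

  X-contains-S : ∀ {u} → inS u ≡ true → X u ≡ true
  X-contains-S {u} Su = cong (_∨ nonleaf u) Su

  counting-bound : Acyclic T → Fin n → 2 * (size X + 2) ≤ 5 * size inS
  counting-bound acyclic v with u , Su ← S-nonempty v =
    subst (λ t → 2 * (t + 2) ≤ 5 * size inS) (sym size-X)
      (counting-arithmetic forest S-bound M-bound O-S-bound O-J-bound)
    where
    forest : E (ind inS) (ind inS) + 2 * (E (ind M) (ind inS) + E (ind O) (ind inS)) + E (ind J) (ind J) + 2
             ≤ 2 * (size inS + (size M + size O))
    forest = subst₂ (λ e x → e + 2 ≤ 2 * x) edges-X size-X
      (Forests.forest-edge-bound T acyclic X (X-contains-S Su))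

theorem2p2 : (n : ℕ) → 2 ≤ n → (T : Graph n) → IsTree T →
    (S : Subset n) → IsSemitotalDominating T S →
    2 * ((n ∸ leaves T) + 2) ≤ 5 * ∣ S ∣
theorem2p2 zero () _ _ _ _
theorem2p2 (suc n) _ T (_ , acyclic) S semi = begin
  2 * (suc n ∸ leaves T + 2) ≤⟨ *-monoʳ-≤ 2 (+-monoˡ-≤ 2 nonleaves≤size-X) ⟩
  2 * (size X + 2)           ≤⟨ counting-bound acyclic zero ⟩
  5 * size inS               ≡⟨ cong (5 *_) (sym (∣∣≡size S)) ⟩
  5 * ∣ S ∣                  ∎
  where
  open ≤-Reasoning
  open SemitotalStructure T S semi
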